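{- Let $G$ be a finite simple graph with a leaf $u$ (vertex of degree one) whose neighbor is $v$, and let $(\mathcal{D},\mathcal{L})$ be an optimal three-color skew zero forcing set for $G$. (i) If $u$ is light blue or dark blue, then $v$ is white. (ii) If $u$ is white, then $v$ is not dark blue.
   Context: Three-color skew zero forcing game on $G$: each vertex is initially colored dark blue, light blue, or white; $\mathcal{D}$ is the set of dark blue and $\mathcal{L}$ the set of light blue vertices. Rule: if $w$ is the only neighbor of a dark blue or light blue vertex $u$ that is not dark blue, then $u$ may force $w$, i.e. $w$ becomes dark blue. $(\mathcal{D},\mathcal{L})$ is a three-color skew zero forcing set if repeated application can make all vertices dark blue. It is optimal if $|\mathcal{D}|$ is the minimum number of dark blue vertices over all three-color skew zero forcing sets for $G$, and among three-color skew zero forcing sets with that many dark blue vertices none has fewer than $|\mathcal{L}|$ light blue vertices. -}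

module Defs where

open import Data.Nat using (ℕ; _≤_)
open import Data.Bool using (Bool; true; false)
open import Data.Fin using (Fin)
open import Data.Fin.Subset using (Subset; _∈_; _∉_; _∪_; ⁅_⁆; ∣_∣)
open import Data.Vec using (tabulate)
open import Data.Sum using (_⊎_)
open import Data.Product using (Σ; _×_; ∃-syntax)
open import Relation.Binary.PropositionalEquality using (_≡_)
open import Relation.Binary.Construct.Closure.ReflexiveTransitive using (Star)

record SimpleGraph (n : ℕ) : Set where
  field
    adj    : Fin n → Fin n → Bool
    sym    : ∀ x y → adj x y ≡ adj y x
    irrefl : ∀ x → adj x x ≡ false
open SimpleGraph public

IsLeafWithNeighbor : ∀ {n} → SimpleGraph n → Fin n → Fin n → Set
IsLeafWithNeighbor G u v = adj G u v ≡ true × (∀ x → adj G u x ≡ true → x ≡ v)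

data Color : Set where
  darkBlue lightBlue white : Color

isDark : Color → Bool
isDark darkBlue  = true
isDark lightBlue = false
isDark white     = false

isLight : Color → Bool
isLight darkBlue  = false
isLight lightBlue = true
isLight white     = false

Coloring : ℕ → Set
Coloring n = Fin n → Color

𝒟 : ∀ {n} → Coloring n → Subset n
𝒟 c = tabulate (λ v → isDark (c v))

ℒ : ∀ {n} → Coloring n → Subset n
ℒ c = tabulate (λ v → isLight (c v))

-- The current state is
-- the set D of dark blue vertices; L is the initial set of light blue vertices
-- (a light blue vertex that has been forced is in D, i.e. dark blue).
data Force {n} (G : SimpleGraph n) (L : Subset n) : Subset n → Subset n → Set where
  force : ∀ {D} (u w : Fin n) →
          (u ∈ D ⊎ u ∈ L) →
          adj G u w ≡ true →
          w ∉ D →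
          (∀ x → adj G u x ≡ true → x ∉ D → x ≡ w) →
          Force G L D (D ∪ ⁅ w ⁆)

IsTCSZFS : ∀ {n} → SimpleGraph n → Coloring n → Set
IsTCSZFS {n} G c =
  ∃[ F ] (Star (Force G (ℒ c)) (𝒟 c) F × (∀ v → v ∈ F))

IsOptimalTCSZFS : ∀ {n} → SimpleGraph n → Coloring n → Set
IsOptimalTCSZFS {n} G c =
  IsTCSZFS G c ×
  (∀ (c' : Coloring n) → IsTCSZFS G c' →
     ∣ 𝒟 c ∣ ≤ ∣ 𝒟 c' ∣ × (∣ 𝒟 c' ∣ ≡ ∣ 𝒟 c ∣ → ∣ ℒ c ∣ ≤ ∣ ℒ c' ∣))

module Submission where

-- A blue leaf u can force its only neighbour v as the very first step, and forcing
-- is monotone in the set of dark blue vertices. Hence recolouring v white, and u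
-- light blue if it was white, keeps a three-color skew zero forcing set one. If v
-- was dark blue this lowers |D|; if v was light blue and u already blue, it keeps D
-- and lowers |L|. Either way optimality is contradicted.

open import Defs hiding (sym)
open import Data.Nat.Properties using (<⇒≱)
open import Data.Bool using (Bool; true; false)
open import Data.Fin using (Fin; _≟_)
open import Data.Fin.Subset using (_∈_; _∉_; _⊆_; _⊂_; _⊄_; _∪_; ⁅_⁆; ∣_∣)
open import Data.Fin.Subset.Properties
  using (_∈?_; x∈⁅x⁆; x∈⁅y⁆⇒x≡y; x∈p∪q⁻; x∈p∪q⁺; p⊂q⇒∣p∣<∣q∣)
open import Data.Vec using (tabulate)
open import Data.Vec.Properties using (lookup∘tabulate; tabulate-cong; []=⇒lookup; lookup⇒[]=)
open import Data.Vec.Functional using (updateAt)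
open import Data.Vec.Functional.Properties using (updateAt-updates; updateAt-minimal)
open import Data.Product using (_,_; proj₁; proj₂; ∃-syntax; _×_)
open import Data.Sum using (_⊎_; inj₁; inj₂)
import Data.Sum as Sum
open import Function using (const; _∘_)
open import Relation.Nullary using (yes; no; contradiction)
open import Relation.Binary.PropositionalEquality
  using (_≡_; _≢_; refl; sym; trans; cong; subst; subst₂)
open import Relation.Binary.Construct.Closure.ReflexiveTransitive using (Star; ε; _◅_; _◅◅_)

∈-tabulate⁺ : ∀ {n} {f : Fin n → Bool} {x} → f x ≡ true → x ∈ tabulate f
∈-tabulate⁺ {f = f} {x} fx = lookup⇒[]= x (tabulate f) (trans (lookup∘tabulate f x) fx)

∈-tabulate⁻ : ∀ {n} {f : Fin n → Bool} {x} → x ∈ tabulate f → f x ≡ true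
∈-tabulate⁻ {f = f} {x} x∈ = trans (sym (lookup∘tabulate f x)) ([]=⇒lookup x∈)

tabulate-⊂ : ∀ {n} {f g : Fin n → Bool} → (∀ x → f x ≡ true → g x ≡ true) →
             ∀ y → f y ≡ false → g y ≡ true → tabulate f ⊂ tabulate g
tabulate-⊂ f⇒g y fy gy =
  (λ x∈ → ∈-tabulate⁺ (f⇒g _ (∈-tabulate⁻ x∈))) ,
  y , ∈-tabulate⁺ gy , λ y∈ → contradiction (trans (sym fy) (∈-tabulate⁻ y∈)) λ ()

data _⊑_ : Color → Color → Set where
  ⊑-refl          : ∀ {k} → k ⊑ k
  white⊑lightBlue : white ⊑ lightBlue

⊑-reflexive : ∀ {k k'} → k ≡ k' → k ⊑ k'
⊑-reflexive refl = ⊑-refl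

⊑-isDark : ∀ {k k'} → k ⊑ k' → isDark k' ≡ isDark k
⊑-isDark ⊑-refl          = refl
⊑-isDark white⊑lightBlue = refl

⊑-isLight : ∀ {k k'} → k ⊑ k' → isLight k ≡ true → isLight k' ≡ true
⊑-isLight ⊑-refl k-light = k-light
⊑-isLight white⊑lightBlue ()

≢white⇒isDark⊎isLight : ∀ {k} → k ≢ white → isDark k ≡ true ⊎ isLight k ≡ true
≢white⇒isDark⊎isLight {darkBlue}  _        = inj₁ refl
≢white⇒isDark⊎isLight {lightBlue} _        = inj₂ refl
≢white⇒isDark⊎isLight {white}     k≢white = contradiction refl k≢white

≢darkBlue⇒¬isDark : ∀ {k} → k ≢ darkBlue → isDark k ≡ false
≢darkBlue⇒¬isDark {darkBlue}  k≢dark = contradiction refl k≢dark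
≢darkBlue⇒¬isDark {lightBlue} _      = refl
≢darkBlue⇒¬isDark {white}     _      = refl

⊑-updateAt-white : ∀ {n} {c : Coloring n} {v} x → x ≢ v → c x ⊑ updateAt c v (const white) x
⊑-updateAt-white {c = c} {v} x x≢v = ⊑-reflexive (sym (updateAt-minimal x v c x≢v))

⊑-updateAt-lightBlue : ∀ {n} {c : Coloring n} {u} → c u ≡ white →
                       ∀ x → c x ⊑ updateAt c u (const lightBlue) x
⊑-updateAt-lightBlue {c = c} {u} cu≡white x with x ≟ u
... | yes refl = subst₂ _⊑_ (sym cu≡white) (sym (updateAt-updates u c)) white⊑lightBlue
... | no x≢u   = ⊑-reflexive (sym (updateAt-minimal x u c x≢u))

module _ {n} {c c' : Coloring n} {v : Fin n} (c'v≡white : c' v ≡ white) where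

  module _ (c⊑c' : ∀ x → x ≢ v → c x ⊑ c' x) where

    𝒟⊆𝒟'∪⁅v⁆ : 𝒟 c ⊆ 𝒟 c' ∪ ⁅ v ⁆
    𝒟⊆𝒟'∪⁅v⁆ {x} x∈ with x ≟ v
    ... | yes refl = x∈p∪q⁺ (inj₂ (x∈⁅x⁆ v))
    ... | no x≢v   =
      x∈p∪q⁺ (inj₁ (∈-tabulate⁺ (trans (⊑-isDark (c⊑c' x x≢v)) (∈-tabulate⁻ x∈))))

    ℒ⊆ℒ'∪⁅v⁆ : ℒ c ⊆ ℒ c' ∪ ⁅ v ⁆
    ℒ⊆ℒ'∪⁅v⁆ {x} x∈ with x ≟ v
    ... | yes refl = x∈p∪q⁺ (inj₂ (x∈⁅x⁆ v))
    ... | no x≢v   = x∈p∪q⁺ (inj₁ (∈-tabulate⁺ (⊑-isLight (c⊑c' x x≢v) (∈-tabulate⁻ x∈))))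

    isDark-c'⇒isDark-c : ∀ x → isDark (c' x) ≡ true → isDark (c x) ≡ true
    isDark-c'⇒isDark-c x c'x-dark with x ≟ v
    ... | yes refl = contradiction (trans (sym c'x-dark) (cong isDark c'v≡white)) λ ()
    ... | no x≢v   = trans (sym (⊑-isDark (c⊑c' x x≢v))) c'x-dark

    𝒟'⊂𝒟 : c v ≡ darkBlue → 𝒟 c' ⊂ 𝒟 c
    𝒟'⊂𝒟 cv≡dark =
      tabulate-⊂ isDark-c'⇒isDark-c v (cong isDark c'v≡white) (cong isDark cv≡dark)

    𝒟'≡𝒟 : c v ≢ darkBlue → 𝒟 c' ≡ 𝒟 c
    𝒟'≡𝒟 cv≢dark = tabulate-cong isDark-c'≡isDark-c
      where
        isDark-c'≡isDark-c : ∀ x → isDark (c' x) ≡ isDark (c x)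
        isDark-c'≡isDark-c x with x ≟ v
        ... | yes refl = trans (cong isDark c'v≡white) (sym (≢darkBlue⇒¬isDark cv≢dark))
        ... | no x≢v   = ⊑-isDark (c⊑c' x x≢v)

  ℒ'⊂ℒ : (∀ x → x ≢ v → c' x ≡ c x) → c v ≡ lightBlue → ℒ c' ⊂ ℒ c
  ℒ'⊂ℒ c'≡c cv≡light =
    tabulate-⊂ isLight-c'⇒isLight-c v (cong isLight c'v≡white) (cong isLight cv≡light)
    where
      isLight-c'⇒isLight-c : ∀ x → isLight (c' x) ≡ true → isLight (c x) ≡ true
      isLight-c'⇒isLight-c x c'x-light with x ≟ v
      ... | yes refl = contradiction (trans (sym c'x-light) (cong isLight c'v≡white)) λ ()
      ... | no x≢v   = trans (cong isLight (sym (c'≡c x x≢v))) c'x-light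

module _ {n} (G : SimpleGraph n) where

  Force*-mono : ∀ {L L' S S' T} → Star (Force G L) S T → S ⊆ S' → L ⊆ L' ∪ S' →
                ∃[ T' ] (Star (Force G L') S' T' × T ⊆ T')
  Force*-mono ε S⊆S' _ = _ , ε , S⊆S'
  -- a step whose target is already dark in S' is skipped; otherwise the same force applies
  Force*-mono {L} {L'} {S' = S'} (force {S} y t y-blue yt _ only ◅ steps) S⊆S' L⊆ with t ∈? S'
  ... | yes t∈S' = Force*-mono steps S∪t⊆S' L⊆
    where
      S∪t⊆S' : S ∪ ⁅ t ⁆ ⊆ S'
      S∪t⊆S' x∈ with x∈p∪q⁻ S ⁅ t ⁆ x∈
      ... | inj₁ x∈S = S⊆S' x∈S
      ... | inj₂ x∈t = subst (_∈ S') (sym (x∈⁅y⁆⇒x≡y t x∈t)) t∈S'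
  ... | no t∉S' with Force*-mono steps S∪t⊆S'∪t L⊆'
    where
      S∪t⊆S'∪t : S ∪ ⁅ t ⁆ ⊆ S' ∪ ⁅ t ⁆
      S∪t⊆S'∪t x∈ = x∈p∪q⁺ (Sum.map₁ S⊆S' (x∈p∪q⁻ S ⁅ t ⁆ x∈))
      L⊆' : L ⊆ L' ∪ (S' ∪ ⁅ t ⁆)
      L⊆' x∈ = x∈p∪q⁺ (Sum.map₂ (λ x∈S' → x∈p∪q⁺ (inj₁ x∈S')) (x∈p∪q⁻ L' S' (L⊆ x∈)))
  ... | T' , steps' , T⊆T' = T' , force y t y-blue' yt t∉S' only' ◅ steps' , T⊆T'
    where
      y-blue' : y ∈ S' ⊎ y ∈ L'
      y-blue' = Sum.[ inj₁ ∘ S⊆S' , (λ y∈L → Sum.swap (x∈p∪q⁻ L' S' (L⊆ y∈L))) ] y-blue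
      only' : ∀ x → adj G y x ≡ true → x ∉ S' → x ≡ t
      only' x yx x∉S' = only x yx (λ x∈S → x∉S' (S⊆S' x∈S))

  leaf≢neighbour : ∀ {u v} → IsLeafWithNeighbor G u v → u ≢ v
  leaf≢neighbour {u} (uv , _) refl = contradiction (trans (sym (irrefl G u)) uv) λ ()

  leaf-forces-neighbour : ∀ {u v L D} → IsLeafWithNeighbor G u v →
                          u ∈ D ⊎ u ∈ L → v ∉ D → Force G L D (D ∪ ⁅ v ⁆)
  leaf-forces-neighbour {u} {v} (uv , only) u-blue v∉D =
    force u v u-blue uv v∉D (λ x ux _ → only x ux)

  IsTCSZFS-transfer : ∀ {c c' S} → Star (Force G (ℒ c')) (𝒟 c') S →
                      𝒟 c ⊆ S → ℒ c ⊆ ℒ c' ∪ S → IsTCSZFS G c → IsTCSZFS G c'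
  IsTCSZFS-transfer reach 𝒟⊆S ℒ⊆ (F , steps , all) with Force*-mono steps 𝒟⊆S ℒ⊆
  ... | F' , steps' , F⊆F' = F' , reach ◅◅ steps' , λ x → F⊆F' (all x)

  leaf-recolouring-preserves-TCSZFS :
    ∀ {u v} {c c' : Coloring n} → IsLeafWithNeighbor G u v →
    c' u ≢ white → c' v ≡ white → (∀ x → x ≢ v → c x ⊑ c' x) →
    IsTCSZFS G c → IsTCSZFS G c'
  leaf-recolouring-preserves-TCSZFS {u} {v} {c} {c'} leaf c'u≢white c'v≡white c⊑c' =
    IsTCSZFS-transfer (leaf-forces-neighbour leaf u-blue v∉𝒟' ◅ ε)
      (𝒟⊆𝒟'∪⁅v⁆ c'v≡white c⊑c') ℒ⊆ℒ'∪𝒟'∪⁅v⁆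
    where
      u-blue : u ∈ 𝒟 c' ⊎ u ∈ ℒ c'
      u-blue = Sum.map ∈-tabulate⁺ ∈-tabulate⁺ (≢white⇒isDark⊎isLight c'u≢white)
      v∉𝒟' : v ∉ 𝒟 c'
      v∉𝒟' v∈ = contradiction (trans (sym (∈-tabulate⁻ v∈)) (cong isDark c'v≡white)) λ ()
      ℒ⊆ℒ'∪𝒟'∪⁅v⁆ : ℒ c ⊆ ℒ c' ∪ (𝒟 c' ∪ ⁅ v ⁆)
      ℒ⊆ℒ'∪𝒟'∪⁅v⁆ x∈ = x∈p∪q⁺ (Sum.map₂ (λ x∈v → x∈p∪q⁺ (inj₂ x∈v))
                                          (x∈p∪q⁻ _ _ (ℒ⊆ℒ'∪⁅v⁆ c'v≡white c⊑c' x∈)))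

  module _ {c : Coloring n} (optimal : IsOptimalTCSZFS G c) {c' : Coloring n}
           (zf : IsTCSZFS G c') where

    optimal⇒𝒟⊄ : 𝒟 c' ⊄ 𝒟 c
    optimal⇒𝒟⊄ c'⊂c = <⇒≱ (p⊂q⇒∣p∣<∣q∣ c'⊂c) (proj₁ (proj₂ optimal c' zf))

    optimal⇒ℒ⊄ : 𝒟 c' ≡ 𝒟 c → ℒ c' ⊄ ℒ c
    optimal⇒ℒ⊄ 𝒟≡ c'⊂c = <⇒≱ (p⊂q⇒∣p∣<∣q∣ c'⊂c) (proj₂ (proj₂ optimal c' zf) (cong ∣_∣ 𝒟≡))

  module _ {u v} {c : Coloring n} (leaf : IsLeafWithNeighbor G u v)
           (optimal : IsOptimalTCSZFS G c) where

    private
      u≢v : u ≢ v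
      u≢v = leaf≢neighbour leaf

      c₁ : Coloring n
      c₁ = updateAt c v (const white)

      c₁v≡white : c₁ v ≡ white
      c₁v≡white = updateAt-updates v c

      c₁≡c : ∀ x → x ≢ v → c₁ x ≡ c x
      c₁≡c x x≢v = updateAt-minimal x v c x≢v

      c₁-zf : c u ≢ white → IsTCSZFS G c₁
      c₁-zf cu≢white = leaf-recolouring-preserves-TCSZFS leaf
                         (cu≢white ∘ trans (sym (c₁≡c u u≢v)))
                         c₁v≡white ⊑-updateAt-white (proj₁ optimal)

    optimal⇒blue-leaf⇒white-neighbour : c u ≢ white → c v ≡ white
    optimal⇒blue-leaf⇒white-neighbour cu≢white with c v in cv
    ... | white     = refl
    ... | darkBlue  = contradiction (𝒟'⊂𝒟 c₁v≡white ⊑-updateAt-white cv)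
                                    (optimal⇒𝒟⊄ optimal (c₁-zf cu≢white))
    ... | lightBlue = contradiction (ℒ'⊂ℒ c₁v≡white c₁≡c cv)
                                    (optimal⇒ℒ⊄ optimal (c₁-zf cu≢white) 𝒟₁≡𝒟)
      where
        𝒟₁≡𝒟 : 𝒟 c₁ ≡ 𝒟 c
        𝒟₁≡𝒟 = 𝒟'≡𝒟 c₁v≡white ⊑-updateAt-white
                 λ cv≡dark → contradiction (trans (sym cv) cv≡dark) λ ()

    optimal⇒white-leaf⇒neighbour≢darkBlue : c u ≡ white → c v ≢ darkBlue
    optimal⇒white-leaf⇒neighbour≢darkBlue cu≡white cv≡dark =
      optimal⇒𝒟⊄ optimal c₂-zf (𝒟'⊂𝒟 c₂v≡white c⊑c₂ cv≡dark)
      where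
        c₂ : Coloring n
        c₂ = updateAt c₁ u (const lightBlue)

        c₂v≡white : c₂ v ≡ white
        c₂v≡white = trans (updateAt-minimal v u c₁ (u≢v ∘ sym)) c₁v≡white

        c⊑c₂ : ∀ x → x ≢ v → c x ⊑ c₂ x
        c⊑c₂ x x≢v = subst (_⊑ c₂ x) (c₁≡c x x≢v)
                       (⊑-updateAt-lightBlue (trans (c₁≡c u u≢v) cu≡white) x)

        c₂-zf : IsTCSZFS G c₂
        c₂-zf = leaf-recolouring-preserves-TCSZFS leaf
                  (λ c₂u≡white → contradiction (trans (sym (updateAt-updates u c₁)) c₂u≡white) λ ())
                  c₂v≡white c⊑c₂ (proj₁ optimal)

lemma3p19 : ∀ {n} (G : SimpleGraph n) (u v : Fin n) (c : Coloring n) →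
            IsLeafWithNeighbor G u v →
            IsOptimalTCSZFS G c →
            ((c u ≢ white → c v ≡ white) × (c u ≡ white → c v ≢ darkBlue))
lemma3p19 G u v c leaf optimal =
  optimal⇒blue-leaf⇒white-neighbour G leaf optimal ,
  optimal⇒white-leaf⇒neighbour≢darkBlue G leaf optimal
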